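{- In the branch structure $\mathcal{M}_{\mathcal{B}}=\langle U,D,\tilde\neg,\tilde\to,\tilde\equiv\rangle$ defined in the context, $\tilde\neg$ is a function on $U$ (i.e. each $w\in U$ is assigned exactly one value) and for all $w\in U$: $\tilde\neg w\in D$ iff $w\notin D$.
   Context: SCI-formulas: over a countably infinite set $\mathsf{AF}$ of atoms, $\varphi ::= p \mid \neg\varphi \mid \varphi\to\varphi \mid \varphi\equiv\varphi$; $\mathsf{FOR}$ is the set of formulas. Tableau system $\mathsf{TC}_{\mathsf{SCI}}$. Let $\mathsf{L}^+,\mathsf{L}^-$ be disjoint countably infinite sets of labels, $\mathsf{L}=\mathsf{L}^+\cup\mathsf{L}^-$; a label written $w^+$ lies in $\mathsf{L}^+$, $w^-$ in $\mathsf{L}^-$, unsuperscripted labels are arbitrary. A labelled formula is $w:\varphi$; equality statements $w=v$ and inequality statements $w\neq v$ may also occur. A tableau is a tree whose nodes carry these items or $\bot$; a branch is a root-to-leaf path identified with its set of items. Rules (premises / alternative conclusion sets separated by $\mid$): decomposition rules (conclusion labels fresh on the branch): $(\neg^+)$ $w^+:\neg\varphi$ / $v^-:\varphi$; $(\neg^-)$ $w^-:\neg\varphi$ / $v^+:\varphi$; $(\to^+)$ $w^+:\varphi\to\psi$ / $\{v^-:\varphi,u^-:\psi\}\mid\{v^-:\varphi,u^+:\psi\}\mid\{v^+:\varphi,u^+:\psi\}$; $(\to^-)$ $w^-:\varphi\to\psi$ / $\{v^+:\varphi,u^-:\psi\}$; $(\equiv^+)$ $w^+:\varphi\equiv\psi$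 / $\{v^+:\varphi,u^+:\psi,v^+=u^+\}\mid\{v^-:\varphi,u^-:\psi,v^-=u^-\}$; $(\equiv^-)$ $w^-:\varphi\equiv\psi$ / $\{v^+:\varphi,u^+:\psi,v^+\neq u^+\}\mid\{v^+:\varphi,u^-:\psi\}\mid\{v^-:\varphi,u^+:\psi\}\mid\{v^-:\varphi,u^-:\psi,v^-\neq u^-\}$. Equality rules, with $\varphi\approx\psi$ abbreviating premises $w:\varphi$, $v:\psi$, $w=v$: $(\equiv^\neg)$ $\varphi\approx\psi$, $u:\neg\varphi$, $y:\neg\psi$ / $u=y$; $(\equiv^\to)$ $\varphi\approx\psi$, $\chi\approx\theta$, $x:\varphi\to\chi$, $z:\psi\to\theta$ / $x=z$; $(\equiv^\equiv)$ $\varphi\approx\psi$, $\chi\approx\theta$, $x:\varphi\equiv\chi$, $z:\psi\equiv\theta$ / $x=z$; $(\mathsf F)$ $w:\varphi$, $v:\varphi$ / $w=v$; $(\mathsf{sym})$ $w=v$ / $v=w$; $(\mathsf{tran})$ $w=v$, $v=u$ / $w=u$. Closure rules: $(\bot_1)$ $w=v$, $w\neq v$ / $\bot$; $(\bot_2)$ $w^+=v^-$ / $\bot$. A decomposition rule may be applied to $w:\varphi$ on a branch only once; an equality rule only if its conclusion is not yet on the branch; closure rules are applied eagerly. A branch is closed if a closure rule was applied on it, open otherwise; fully expanded if closed or no rule is applicable. Branch structure. Let $\varphi\in\mathsf{FOR}$, $\mathbf{w}^-\in\mathsf{L}^-$, and $\mathcal{B}$ an open fully expanded branch of a tableau with root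 $\mathbf{w}^-:\varphi$. $\mathsf{L}_{\mathcal{B}}$ is the set of labels $w$ with $w:\psi$ on $\mathcal{B}$ for some $\psi$; $\mathsf{L}_{\mathcal{B}}^\pm=\mathsf{L}_{\mathcal{B}}\cap\mathsf{L}^\pm$; $w\sim v$ iff $w=v$ occurs on $\mathcal{B}$ (an equivalence relation on $\mathsf{L}_{\mathcal{B}}$ never relating a label in $\mathsf{L}^+$ to one in $\mathsf{L}^-$). $\mathsf{ML}_{\mathcal{B}}^+$ contains exactly one label from each $\sim$-class of $\mathsf{L}_{\mathcal{B}}^+$; $\mathsf{ML}_{\mathcal{B}}^-$ exactly one label from each $\sim$-class of $\mathsf{L}_{\mathcal{B}}^-$, chosen with $\mathbf{w}^-\in\mathsf{ML}_{\mathcal{B}}^-$; $\mathsf{ML}_{\mathcal{B}}=\mathsf{ML}_{\mathcal{B}}^+\cup\mathsf{ML}_{\mathcal{B}}^-$. Let $\mathbf{w}^+$ be an object not in $\mathsf{L}_{\mathcal{B}}$; for $w\in U$ and a label $t$, "$w\sim t$" is false if $w=\mathbf{w}^+$. $w\in\mathsf{ML}_{\mathcal{B}}$ is $(\neg)$-closed if there are $\psi\in\mathsf{FOR}$, $u\in\mathsf{ML}_{\mathcal{B}}$, $v,t\in\mathsf{L}_{\mathcal{B}}$ with $w\sim v$, $u\sim t$, and $v:\psi$, $t:\neg\psi$ on $\mathcal{B}$. For $\#\in\{\to,\equiv\}$, a pair $(w,v)\in\mathsf{ML}_{\mathcal{B}}^2$ is $(\#)$-closed if there are $\psi,\theta\in\mathsf{FOR}$,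 $u\in\mathsf{ML}_{\mathcal{B}}$, $t,x,y\in\mathsf{L}_{\mathcal{B}}$ with $w\sim t$, $v\sim x$, $u\sim y$ and $t:\psi$, $x:\theta$, $y:(\psi\#\theta)$ on $\mathcal{B}$ ($\mathbf{w}^+$ is never $(\neg)$-closed, and pairs involving it are never closed). Set $D=\mathsf{ML}_{\mathcal{B}}^+\cup\{\mathbf{w}^+\}$, $U=D\cup\mathsf{ML}_{\mathcal{B}}^-$. For $w,v\in U$: $\tilde\neg w=u\in\mathsf{ML}_{\mathcal{B}}$ if there are $\psi$ and $v',t\in\mathsf{L}_{\mathcal{B}}$ with $w\sim v'$, $u\sim t$, $v':\psi$ and $t:\neg\psi$ on $\mathcal{B}$; $\tilde\neg w=\mathbf{w}^+$ if $w$ is not $(\neg)$-closed and $w\notin D$; $\tilde\neg w=\mathbf{w}^-$ otherwise. $w\tilde\to v=u\in\mathsf{ML}_{\mathcal{B}}$ if there are $\psi,\theta$ and $t,x,y\in\mathsf{L}_{\mathcal{B}}$ with $w\sim t$, $v\sim x$, $u\sim y$, $t:\psi$, $x:\theta$, $y:(\psi\to\theta)$ on $\mathcal{B}$; $w\tilde\to v=\mathbf{w}^+$ if $v=\mathbf{w}^+$, or ($w=\mathbf{w}^+$ and $v\in D$), or ($(w,v)$ is not $(\to)$-closed and ($w\notin D$ or $v\in D$)); $w\tilde\to v=\mathbf{w}^-$ otherwise. $w\tilde\equiv v=u\in\mathsf{ML}_{\mathcal{B}}$ if there are $\psi,\theta$ and $t,x,y\in\mathsf{L}_{\mathcal{B}}$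 with $w\sim t$, $v\sim x$, $u\sim y$, $t:\psi$, $x:\theta$, $y:(\psi\equiv\theta)$ on $\mathcal{B}$; $w\tilde\equiv v=\mathbf{w}^+$ if $w=v$ and ($w=\mathbf{w}^+$ or $(w,v)$ is not $(\equiv)$-closed); $w\tilde\equiv v=\mathbf{w}^-$ otherwise. $\mathcal{M}_{\mathcal{B}}=\langle U,D,\tilde\neg,\tilde\to,\tilde\equiv\rangle$. -}

module Defs where

open import Data.Nat using (ℕ)
open import Data.Product using (Σ; Σ-syntax; _×_; _,_)
open import Data.Sum using (_⊎_)
open import Data.Unit using (⊤)
open import Data.Empty using (⊥)
open import Data.List using (List; []; _∷_; _++_; [_])
open import Data.List.Membership.Propositional using (_∈_; _∉_)
open import Data.List.Relation.Unary.Any using (Any)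
open import Relation.Nullary using (¬_)
open import Relation.Binary.PropositionalEquality using (_≡_; _≢_)
open import Relation.Binary.Construct.Closure.ReflexiveTransitive using (Star)

-- SCI formulas over the countably infinite set of atoms AF = ℕ

infixr 8 _⇒_ _≡ᶠ_
infix 9 ~_
data Fm : Set where
  atom  : ℕ → Fm
  ~_    : Fm → Fm
  _⇒_   : Fm → Fm → Fm
  _≡ᶠ_  : Fm → Fm → Fm     -- identity connective ≡

-- Labels: L = L⁺ ∪ L⁻, two disjoint countably infinite sets

data Label : Set where
  pos : ℕ → Label
  neg : ℕ → Label

infix 6 _∶_ _≐_ _≭_
data Item : Set where
  _∶_  : Label → Fm → Item
  _≐_  : Label → Label → Item
  _≭_  : Label → Label → Item
  bot  : Item

Occurs : Label → Item → Set
Occurs l (w ∶ φ) = l ≡ w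
Occurs l (w ≐ v) = (l ≡ w) ⊎ (l ≡ v)
Occurs l (w ≭ v) = (l ≡ w) ⊎ (l ≡ v)
Occurs l bot     = ⊥

Fresh : List Item → Label → Set
Fresh B l = ¬ Any (Occurs l) B

-- Decomposition rules: Decomp B w φ C  says that C is one of the
-- alternative conclusion sets of the decomposition rule for w : φ,
-- with conclusion labels fresh on B (and pairwise distinct).

data Decomp (B : List Item) : Label → Fm → List Item → Set where
  neg⁺  : ∀ {k φ} i → Fresh B (neg i) →
          Decomp B (pos k) (~ φ) [ neg i ∶ φ ]
  neg⁻  : ∀ {k φ} i → Fresh B (pos i) →
          Decomp B (neg k) (~ φ) [ pos i ∶ φ ]
  imp⁺₁ : ∀ {k φ ψ} i j → Fresh B (neg i) → Fresh B (neg j) → i ≢ j →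
          Decomp B (pos k) (φ ⇒ ψ) (neg i ∶ φ ∷ neg j ∶ ψ ∷ [])
  imp⁺₂ : ∀ {k φ ψ} i j → Fresh B (neg i) → Fresh B (pos j) →
          Decomp B (pos k) (φ ⇒ ψ) (neg i ∶ φ ∷ pos j ∶ ψ ∷ [])
  imp⁺₃ : ∀ {k φ ψ} i j → Fresh B (pos i) → Fresh B (pos j) → i ≢ j →
          Decomp B (pos k) (φ ⇒ ψ) (pos i ∶ φ ∷ pos j ∶ ψ ∷ [])
  imp⁻  : ∀ {k φ ψ} i j → Fresh B (pos i) → Fresh B (neg j) →
          Decomp B (neg k) (φ ⇒ ψ) (pos i ∶ φ ∷ neg j ∶ ψ ∷ [])
  eqv⁺₁ : ∀ {k φ ψ} i j → Fresh B (pos i) → Fresh B (pos j) → i ≢ j →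
          Decomp B (pos k) (φ ≡ᶠ ψ) (pos i ∶ φ ∷ pos j ∶ ψ ∷ pos i ≐ pos j ∷ [])
  eqv⁺₂ : ∀ {k φ ψ} i j → Fresh B (neg i) → Fresh B (neg j) → i ≢ j →
          Decomp B (pos k) (φ ≡ᶠ ψ) (neg i ∶ φ ∷ neg j ∶ ψ ∷ neg i ≐ neg j ∷ [])
  eqv⁻₁ : ∀ {k φ ψ} i j → Fresh B (pos i) → Fresh B (pos j) → i ≢ j →
          Decomp B (neg k) (φ ≡ᶠ ψ) (pos i ∶ φ ∷ pos j ∶ ψ ∷ pos i ≭ pos j ∷ [])
  eqv⁻₂ : ∀ {k φ ψ} i j → Fresh B (pos i) → Fresh B (neg j) →
          Decomp B (neg k) (φ ≡ᶠ ψ) (pos i ∶ φ ∷ neg j ∶ ψ ∷ [])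
  eqv⁻₃ : ∀ {k φ ψ} i j → Fresh B (neg i) → Fresh B (pos j) →
          Decomp B (neg k) (φ ≡ᶠ ψ) (neg i ∶ φ ∷ pos j ∶ ψ ∷ [])
  eqv⁻₄ : ∀ {k φ ψ} i j → Fresh B (neg i) → Fresh B (neg j) → i ≢ j →
          Decomp B (neg k) (φ ≡ᶠ ψ) (neg i ∶ φ ∷ neg j ∶ ψ ∷ neg i ≭ neg j ∷ [])

-- Equality rules: EqRule B c  says the premises of an equality rule
-- with conclusion c are on B.

data EqRule (B : List Item) : Item → Set where
  r≡¬   : ∀ {w v u y φ ψ} →
          (w ∶ φ) ∈ B → (v ∶ ψ) ∈ B → (w ≐ v) ∈ B →
          (u ∶ ~ φ) ∈ B → (y ∶ ~ ψ) ∈ B → EqRule B (u ≐ y)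
  r≡→   : ∀ {w v w' v' x z φ ψ χ θ} →
          (w ∶ φ) ∈ B → (v ∶ ψ) ∈ B → (w ≐ v) ∈ B →
          (w' ∶ χ) ∈ B → (v' ∶ θ) ∈ B → (w' ≐ v') ∈ B →
          (x ∶ (φ ⇒ χ)) ∈ B → (z ∶ (ψ ⇒ θ)) ∈ B → EqRule B (x ≐ z)
  r≡≡   : ∀ {w v w' v' x z φ ψ χ θ} →
          (w ∶ φ) ∈ B → (v ∶ ψ) ∈ B → (w ≐ v) ∈ B →
          (w' ∶ χ) ∈ B → (v' ∶ θ) ∈ B → (w' ≐ v') ∈ B →
          (x ∶ (φ ≡ᶠ χ)) ∈ B → (z ∶ (ψ ≡ᶠ θ)) ∈ B → EqRule B (x ≐ z)
  rF    : ∀ {w v φ} → (w ∶ φ) ∈ B → (v ∶ φ) ∈ B → EqRule B (w ≐ v)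
  rsym  : ∀ {w v} → (w ≐ v) ∈ B → EqRule B (v ≐ w)
  rtran : ∀ {w v u} → (w ≐ v) ∈ B → (v ≐ u) ∈ B → EqRule B (w ≐ u)

data CloseRule (B : List Item) : Set where
  r⊥₁ : ∀ {w v} → (w ≐ v) ∈ B → (w ≭ v) ∈ B → CloseRule B
  r⊥₂ : ∀ {i j} → (pos i ≐ neg j) ∈ B → CloseRule B

-- Branch states: the items of the branch, together with the labelled
-- formulas to which a decomposition rule has already been applied.

record State : Set where
  constructor ⟨_,_⟩
  field
    items : List Item
    done  : List (Label × Fm)
open State public

-- closure rules are applied eagerly: any other rule may only be applied
-- if no closure rule is pending
Eager : List Item → Set
Eager B = CloseRule B → bot ∈ B

infix 3 _⟶_
data _⟶_ : State → State → Set where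
  decomp  : ∀ {B d w φ C} → Eager B → (w ∶ φ) ∈ B → (w , φ) ∉ d →
            Decomp B w φ C → ⟨ B , d ⟩ ⟶ ⟨ B ++ C , (w , φ) ∷ d ⟩
  equal   : ∀ {B d c} → Eager B → EqRule B c → c ∉ B →
            ⟨ B , d ⟩ ⟶ ⟨ B ++ [ c ] , d ⟩
  close   : ∀ {B d} → CloseRule B → bot ∉ B →
            ⟨ B , d ⟩ ⟶ ⟨ B ++ [ bot ] , d ⟩

-- initial branch of a tableau with root  w⁻ : φ , w⁻ = neg n
initial : ℕ → Fm → State
initial n φ = ⟨ [ neg n ∶ φ ] , [] ⟩

IsBranch : ℕ → Fm → State → Set
IsBranch n φ S = Star _⟶_ (initial n φ) S

Closed : State → Set
Closed S = bot ∈ items S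

Open : State → Set
Open S = ¬ Closed S

FullyExpanded : State → Set
FullyExpanded S = Closed S ⊎ (∀ S' → ¬ (S ⟶ S'))

InL : List Item → Label → Set
InL B w = Σ[ ψ ∈ Fm ] (w ∶ ψ) ∈ B

_⊢_~_ : List Item → Label → Label → Set
B ⊢ w ~ v = (w ≐ v) ∈ B

-- ML⁺_B : exactly one label from each ~-class of L⁺_B
IsMLpos : List Item → (Label → Set) → Set
IsMLpos B ML =
  (∀ w → ML w → Σ[ k ∈ ℕ ] (w ≡ pos k) × InL B w) ×
  (∀ k → InL B (pos k) →
     Σ[ m ∈ Label ] ML m × (B ⊢ pos k ~ m) ×
       (∀ m' → ML m' → B ⊢ pos k ~ m' → m' ≡ m))

-- ML⁻_B : exactly one label from each ~-class of L⁻_B, with w⁻ = neg n in it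
IsMLneg : List Item → ℕ → (Label → Set) → Set
IsMLneg B n ML =
  (∀ w → ML w → Σ[ k ∈ ℕ ] (w ≡ neg k) × InL B w) ×
  (∀ k → InL B (neg k) →
     Σ[ m ∈ Label ] ML m × (B ⊢ neg k ~ m) ×
       (∀ m' → ML m' → B ⊢ neg k ~ m' → m' ≡ m)) ×
  ML (neg n)

-- Elements of the universe: labels, or the extra object w⁺ (not a label)
data Elem : Set where
  lab   : Label → Elem
  wplus : Elem

module Structure (B : List Item) (MLp MLn : Label → Set) (n : ℕ) where

  InML : Elem → Set
  InML (lab w) = MLp w ⊎ MLn w
  InML wplus   = ⊥

  InMLneg : Elem → Set
  InMLneg (lab w) = MLn w
  InMLneg wplus   = ⊥

  InD : Elem → Set
  InD (lab w) = MLp w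
  InD wplus   = ⊤

  InU : Elem → Set
  InU e = InD e ⊎ InMLneg e

  Sim : Elem → Label → Set
  Sim (lab w) t = B ⊢ w ~ t
  Sim wplus   t = ⊥

  NegClosed : Elem → Set
  NegClosed e = InML e ×
    Σ[ ψ ∈ Fm ] Σ[ u ∈ Label ] Σ[ v ∈ Label ] Σ[ t ∈ Label ]
      InML (lab u) × Sim e v × (B ⊢ u ~ t) × (v ∶ ψ) ∈ B × (t ∶ ~ ψ) ∈ B

  -- the condition of the first clause of ¬̃ w = u
  Case₁ : Elem → Label → Set
  Case₁ e u = InML (lab u) ×
    Σ[ ψ ∈ Fm ] Σ[ v' ∈ Label ] Σ[ t ∈ Label ]
      Sim e v' × (B ⊢ u ~ t) × (v' ∶ ψ) ∈ B × (t ∶ ~ ψ) ∈ B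

  -- the (a priori relational) definition of ¬̃ : NegRel w u  reads "¬̃ w = u"
  data NegRel (e : Elem) : Elem → Set where
    case₁ : ∀ {u} → Case₁ e u → NegRel e (lab u)
    case₂ : ¬ NegClosed e → ¬ InD e → NegRel e wplus
    case₃ : (∀ u → ¬ Case₁ e u) → ¬ (¬ NegClosed e × ¬ InD e) →
            NegRel e (lab (neg n))

{-# OPTIONS --safe #-}
module Submission where

-- On an open fully expanded branch no closure rule fires and every equality
-- rule has already been applied, so ~ is an equivalence relation that never
-- relates labels of different polarity and, by (≡¬), sends equivalent formulas
-- to equivalent negations. Hence the first clause defining ¬̃ w picks at most
-- one element of ML_B, it applies exactly when w is (¬)-closed, and whether it
-- applies is decidable because the branch is finite; so exactly one clause
-- defines ¬̃ w. For the second claim, in the first clause w ~ v' : ψ and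
-- u ~ t : ¬ψ; the rule (¬±) was applied to t : ¬ψ and produced a label of the
-- opposite polarity carrying ψ, which (F) makes equivalent to v', so u and w
-- have opposite polarities.

open import Defs
open import Data.Bool using (Bool; true; false)
open import Data.Empty using (⊥)
open import Data.List using (List; _∷_; map)
open import Data.Nat.ListAction using (sum)
open import Data.List.Membership.Propositional using (_∈_; find; lose)
open import Data.List.Membership.Propositional.Properties using (∈-++⁺ˡ; ∈-++⁺ʳ)
import Data.List.Membership.DecPropositional as DecMembership
open import Data.List.Relation.Unary.Any using (Any; here; there; any?)
open import Data.Nat using (ℕ; suc; _+_; _≤_; _<_)
open import Data.Nat.Properties using (≤-refl; ≤-trans; m≤m+n; m≤n+m; <⇒≱)
import Data.Nat.Properties as ℕ
open import Data.Product using (Σ-syntax; ∃; ∃-syntax; _×_; _,_; proj₁; proj₂)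
open import Data.Product.Properties using (≡-dec)
open import Data.Sum using (inj₁; inj₂; [_,_])
open import Data.Unit using (tt)
open import Function.Bundles using (_⇔_; mk⇔)
open import Relation.Binary.Definitions using (DecidableEquality)
open import Relation.Binary.Construct.Closure.ReflexiveTransitive using (Star; ε; _◅_)
open import Relation.Binary.PropositionalEquality using (_≡_; _≢_; refl; sym; trans; cong)
open import Relation.Nullary using (¬_; Dec; yes; no; contradiction)
open import Relation.Nullary.Decidable using (map′; _×-dec_)

_≟ˡ_ : DecidableEquality Label
pos i ≟ˡ pos j = map′ (cong pos) (λ { refl → refl }) (i ℕ.≟ j)
neg i ≟ˡ neg j = map′ (cong neg) (λ { refl → refl }) (i ℕ.≟ j)
pos _ ≟ˡ neg _ = no λ ()
neg _ ≟ˡ pos _ = no λ ()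

_≟ᶠ_ : DecidableEquality Fm
atom i ≟ᶠ atom j = map′ (cong atom) (λ { refl → refl }) (i ℕ.≟ j)
(~ φ) ≟ᶠ (~ ψ) = map′ (cong ~_) (λ { refl → refl }) (φ ≟ᶠ ψ)
(φ ⇒ χ) ≟ᶠ (ψ ⇒ θ) =
  map′ (λ { (refl , refl) → refl }) (λ { refl → refl , refl }) (φ ≟ᶠ ψ ×-dec χ ≟ᶠ θ)
(φ ≡ᶠ χ) ≟ᶠ (ψ ≡ᶠ θ) =
  map′ (λ { (refl , refl) → refl }) (λ { refl → refl , refl }) (φ ≟ᶠ ψ ×-dec χ ≟ᶠ θ)
atom _ ≟ᶠ (~ _) = no λ ()
atom _ ≟ᶠ (_ ⇒ _) = no λ ()
atom _ ≟ᶠ (_ ≡ᶠ _) = no λ ()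
(~ _) ≟ᶠ atom _ = no λ ()
(~ _) ≟ᶠ (_ ⇒ _) = no λ ()
(~ _) ≟ᶠ (_ ≡ᶠ _) = no λ ()
(_ ⇒ _) ≟ᶠ atom _ = no λ ()
(_ ⇒ _) ≟ᶠ (~ _) = no λ ()
(_ ⇒ _) ≟ᶠ (_ ≡ᶠ _) = no λ ()
(_ ≡ᶠ _) ≟ᶠ atom _ = no λ ()
(_ ≡ᶠ _) ≟ᶠ (~ _) = no λ ()
(_ ≡ᶠ _) ≟ᶠ (_ ⇒ _) = no λ ()

≐-∈? : ∀ w v (B : List Item) → Dec ((w ≐ v) ∈ B)
≐-∈? w v = any? is-w≐v
  where
  is-w≐v : ∀ it → Dec ((w ≐ v) ≡ it)
  is-w≐v (a ≐ b) =
    map′ (λ { (refl , refl) → refl }) (λ { refl → refl , refl }) (w ≟ˡ a ×-dec v ≟ˡ b)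
  is-w≐v (_ ∶ _) = no λ ()
  is-w≐v (_ ≭ _) = no λ ()
  is-w≐v bot = no λ ()

decomposed? : ∀ (p : Label × Fm) d → Dec (p ∈ d)
decomposed? = DecMembership._∈?_ (≡-dec _≟ˡ_ _≟ᶠ_)

index : Label → ℕ
index (pos i) = i
index (neg i) = i

weight : Item → ℕ
weight (w ∶ _) = index w
weight (w ≐ v) = index w + index v
weight (w ≭ v) = index w + index v
weight bot = 0

index≤weight : ∀ {l} it → Occurs l it → index l ≤ weight it
index≤weight (_ ∶ _) refl = ≤-refl
index≤weight (w ≐ v) (inj₁ refl) = m≤m+n (index w) (index v)
index≤weight (w ≐ v) (inj₂ refl) = m≤n+m (index v) (index w)
index≤weight (w ≭ v) (inj₁ refl) = m≤m+n (index w) (index v)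
index≤weight (w ≭ v) (inj₂ refl) = m≤n+m (index v) (index w)

index≤total-weight : ∀ {l} B → Any (Occurs l) B → index l ≤ sum (map weight B)
index≤total-weight (it ∷ B) (here o) = ≤-trans (index≤weight it o) (m≤m+n _ _)
index≤total-weight (it ∷ B) (there o) = ≤-trans (index≤total-weight B o) (m≤n+m _ _)

heavy⇒fresh : ∀ B l → sum (map weight B) < index l → Fresh B l
heavy⇒fresh B l heavy o = <⇒≱ heavy (index≤total-weight B o)

fresh-pos : ∀ B → Fresh B (pos (suc (sum (map weight B))))
fresh-pos B = heavy⇒fresh B _ ≤-refl

fresh-neg : ∀ B → Fresh B (neg (suc (sum (map weight B))))
fresh-neg B = heavy⇒fresh B _ ≤-refl

positive : Label → Bool
positive (pos _) = true
positive (neg _) = false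

NegationsDecomposed : State → Set
NegationsDecomposed S = ∀ {w ψ} → (w , ~ ψ) ∈ done S →
  ∃[ x ] positive x ≢ positive w × (x ∶ ψ) ∈ items S

⟶-preserves-NegationsDecomposed : ∀ {S T} → S ⟶ T →
  NegationsDecomposed S → NegationsDecomposed T
⟶-preserves-NegationsDecomposed {⟨ B , _ ⟩} (decomp _ _ _ (neg⁺ i _)) _ (here refl) =
  neg i , (λ ()) , ∈-++⁺ʳ B (here refl)
⟶-preserves-NegationsDecomposed {⟨ B , _ ⟩} (decomp _ _ _ (neg⁻ i _)) _ (here refl) =
  pos i , (λ ()) , ∈-++⁺ʳ B (here refl)
⟶-preserves-NegationsDecomposed (decomp _ _ _ _) nd (there p) =
  let x , x≠ , x∈ = nd p in x , x≠ , ∈-++⁺ˡ x∈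
⟶-preserves-NegationsDecomposed (equal _ _ _) nd p =
  let x , x≠ , x∈ = nd p in x , x≠ , ∈-++⁺ˡ x∈
⟶-preserves-NegationsDecomposed (close _ _) nd p =
  let x , x≠ , x∈ = nd p in x , x≠ , ∈-++⁺ˡ x∈

branch-NegationsDecomposed : ∀ {n φ S} → IsBranch n φ S → NegationsDecomposed S
branch-NegationsDecomposed = go (λ ())
  where
  go : ∀ {S T} → NegationsDecomposed S → Star _⟶_ S T → NegationsDecomposed T
  go nd ε = nd
  go nd (step ◅ steps) = go (⟶-preserves-NegationsDecomposed step nd) steps

module NegatedClass (B : List Item) where

  NegatedClass : Label → Set
  NegatedClass w = Σ[ ψ ∈ Fm ] Σ[ v' ∈ Label ] Σ[ t ∈ Label ]
    (w ≐ v') ∈ B × (v' ∶ ψ) ∈ B × (t ∶ ~ ψ) ∈ B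

  private
    CarriesInClass : Label → Fm → Item → Set
    CarriesInClass w ψ (v ∶ χ) = χ ≡ ψ × (w ≐ v) ∈ B
    CarriesInClass _ _ _ = ⊥

    carriesInClass? : ∀ w ψ it → Dec (CarriesInClass w ψ it)
    carriesInClass? w ψ (v ∶ χ) = χ ≟ᶠ ψ ×-dec ≐-∈? w v B
    carriesInClass? _ _ (_ ≐ _) = no λ ()
    carriesInClass? _ _ (_ ≭ _) = no λ ()
    carriesInClass? _ _ bot = no λ ()

    NegationOfClass : Label → Item → Set
    NegationOfClass w (_ ∶ ~ ψ) = Any (CarriesInClass w ψ) B
    NegationOfClass _ _ = ⊥

    negationOfClass? : ∀ w it → Dec (NegationOfClass w it)
    negationOfClass? w (_ ∶ ~ ψ) = any? (carriesInClass? w ψ) B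
    negationOfClass? _ (_ ∶ atom _) = no λ ()
    negationOfClass? _ (_ ∶ (_ ⇒ _)) = no λ ()
    negationOfClass? _ (_ ∶ (_ ≡ᶠ _)) = no λ ()
    negationOfClass? _ (_ ≐ _) = no λ ()
    negationOfClass? _ (_ ≭ _) = no λ ()
    negationOfClass? _ bot = no λ ()

    carrier : ∀ {w ψ} it → it ∈ B → CarriesInClass w ψ it →
      ∃[ v' ] (w ≐ v') ∈ B × (v' ∶ ψ) ∈ B
    carrier (v ∶ _) v∈ (refl , w≐v) = v , w≐v , v∈

    negatedClass : ∀ {w} it → it ∈ B → NegationOfClass w it → NegatedClass w
    negatedClass (t ∶ ~ ψ) t∈ c =
      let it , it∈ , carries = find c
          v' , w≐v' , v'∈ = carrier it it∈ carries
      in ψ , v' , t , w≐v' , v'∈ , t∈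

  negatedClass? : ∀ w → Dec (NegatedClass w)
  negatedClass? w = map′ fromAny toAny (any? (negationOfClass? w) B)
    where
    fromAny : Any (NegationOfClass w) B → NegatedClass w
    fromAny a = let it , it∈ , negation = find a in negatedClass it it∈ negation
    toAny : NegatedClass w → Any (NegationOfClass w) B
    toAny (_ , _ , _ , w≐v' , v'∈ , t∈) = lose t∈ (lose v'∈ (refl , w≐v'))

module Saturated {S : State} (S-open : Open S) (S-expanded : FullyExpanded S) where

  private
    B : List Item
    B = items S

  stuck : ∀ {T} → ¬ (S ⟶ T)
  stuck {T} step = [ S-open , (λ final → final T step) ] S-expanded

  no-CloseRule : ¬ CloseRule B
  no-CloseRule r = stuck (close r S-open)

  eager : Eager B
  eager r = contradiction r no-CloseRule

  EqRule⇒∈ : ∀ {w v} → EqRule B (w ≐ v) → (w ≐ v) ∈ B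
  EqRule⇒∈ {w} {v} r with ≐-∈? w v B
  ... | yes w≐v = w≐v
  ... | no w≐v∉ = contradiction (equal eager r w≐v∉) stuck

  ≐-refl : ∀ {w ψ} → (w ∶ ψ) ∈ B → (w ≐ w) ∈ B
  ≐-refl w∈ = EqRule⇒∈ (rF w∈ w∈)

  ≐-sym : ∀ {w v} → (w ≐ v) ∈ B → (v ≐ w) ∈ B
  ≐-sym w≐v = EqRule⇒∈ (rsym w≐v)

  ≐-trans : ∀ {w v u} → (w ≐ v) ∈ B → (v ≐ u) ∈ B → (w ≐ u) ∈ B
  ≐-trans w≐v v≐u = EqRule⇒∈ (rtran w≐v v≐u)

  ≐⇒same-polarity : ∀ {w v} → (w ≐ v) ∈ B → positive w ≡ positive v
  ≐⇒same-polarity {pos _} {pos _} _ = refl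
  ≐⇒same-polarity {neg _} {neg _} _ = refl
  ≐⇒same-polarity {pos _} {neg _} w≐v = contradiction (r⊥₂ w≐v) no-CloseRule
  ≐⇒same-polarity {neg _} {pos _} w≐v = contradiction (r⊥₂ (≐-sym w≐v)) no-CloseRule

  negation-decomposed : NegationsDecomposed S → ∀ {t ψ} → (t ∶ ~ ψ) ∈ B →
    ∃[ x ] positive x ≢ positive t × (x ∶ ψ) ∈ B
  negation-decomposed nd {t} {ψ} t∈ with decomposed? (t , ~ ψ) (done S)
  ... | yes done∋t = nd done∋t
  negation-decomposed nd {pos _} t∈ | no done∌t =
    contradiction (decomp eager t∈ done∌t (neg⁺ _ (fresh-neg B))) stuck
  negation-decomposed nd {neg _} t∈ | no done∌t =
    contradiction (decomp eager t∈ done∌t (neg⁻ _ (fresh-pos B))) stuck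

module Negation {φ : Fm} {n : ℕ} {S : State} (branch : IsBranch n φ S)
  (S-open : Open S) (S-expanded : FullyExpanded S) (MLp MLn : Label → Set)
  (isMLp : IsMLpos (items S) MLp) (isMLn : IsMLneg (items S) n MLn) where

  private
    B : List Item
    B = items S

  open Saturated S-open S-expanded
  open NegatedClass B
  open Structure B MLp MLn n

  MLp⇒positive : ∀ {u} → MLp u → positive u ≡ true
  MLp⇒positive {u} u∈ with proj₁ isMLp u u∈
  ... | _ , refl , _ = refl

  MLn⇒negative : ∀ {u} → MLn u → positive u ≡ false
  MLn⇒negative {u} u∈ with proj₁ isMLn u u∈
  ... | _ , refl , _ = refl

  ML-unique : ∀ {u u'} → InML (lab u) → InML (lab u') → (u ≐ u') ∈ B → u ≡ u'
  ML-unique {u} {u'} (inj₁ u∈) (inj₁ u'∈) u≐u' with proj₁ isMLp u u∈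
  ... | k , refl , labelled with proj₂ isMLp k labelled
  ... | _ , _ , _ , unique =
    trans (unique u u∈ (≐-refl (proj₂ labelled))) (sym (unique u' u'∈ u≐u'))
  ML-unique {u} {u'} (inj₂ u∈) (inj₂ u'∈) u≐u' with proj₁ isMLn u u∈
  ... | k , refl , labelled with proj₁ (proj₂ isMLn) k labelled
  ... | _ , _ , _ , unique =
    trans (unique u u∈ (≐-refl (proj₂ labelled))) (sym (unique u' u'∈ u≐u'))
  ML-unique (inj₁ u∈) (inj₂ u'∈) u≐u' with () ←
    trans (sym (MLp⇒positive u∈)) (trans (≐⇒same-polarity u≐u') (MLn⇒negative u'∈))
  ML-unique (inj₂ u∈) (inj₁ u'∈) u≐u' with () ←
    trans (sym (MLp⇒positive u'∈)) (trans (sym (≐⇒same-polarity u≐u')) (MLn⇒negative u∈))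

  representative : ∀ {t} → InL B t → ∃[ m ] InML (lab m) × (m ≐ t) ∈ B
  representative {pos k} labelled =
    let m , m∈ , k≐m , _ = proj₂ isMLp k labelled in m , inj₁ m∈ , ≐-sym k≐m
  representative {neg k} labelled =
    let m , m∈ , k≐m , _ = proj₁ (proj₂ isMLn) k labelled in m , inj₂ m∈ , ≐-sym k≐m

  MLn⇒¬MLp : ∀ {u} → MLn u → ¬ MLp u
  MLn⇒¬MLp u∈n u∈p with () ← trans (sym (MLp⇒positive u∈p)) (MLn⇒negative u∈n)

  ¬Case₁-w⁺ : ∀ {u} → ¬ Case₁ wplus u
  ¬Case₁-w⁺ (_ , _ , _ , _ , () , _)

  Case₁⇒NegClosed : ∀ {e u} → InML e → Case₁ e u → NegClosed e
  Case₁⇒NegClosed e∈ (u∈ , ψ , v' , t , e~v' , u≐t , v'∈ , t∈) =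
    e∈ , ψ , _ , v' , t , u∈ , e~v' , u≐t , v'∈ , t∈

  NegClosed⇒Case₁ : ∀ {e} → NegClosed e → ∃ (Case₁ e)
  NegClosed⇒Case₁ (_ , ψ , u , v , t , u∈ , e~v , u≐t , v∈ , t∈) =
    u , u∈ , ψ , v , t , e~v , u≐t , v∈ , t∈

  ¬Case₁⇒¬NegClosed : ∀ {e} → (∀ u → ¬ Case₁ e u) → ¬ NegClosed e
  ¬Case₁⇒¬NegClosed ¬c closed = let u , c = NegClosed⇒Case₁ closed in ¬c u c

  ¬NegatedClass⇒¬Case₁ : ∀ {w} → ¬ NegatedClass w → ∀ u → ¬ Case₁ (lab w) u
  ¬NegatedClass⇒¬Case₁ ¬negated _ (_ , ψ , v' , t , w≐v' , _ , v'∈ , t∈) =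
    ¬negated (ψ , v' , t , w≐v' , v'∈ , t∈)

  NegatedClass⇒Case₁ : ∀ {w} → NegatedClass w → ∃ (Case₁ (lab w))
  NegatedClass⇒Case₁ (ψ , v' , t , w≐v' , v'∈ , t∈) =
    let m , m∈ , m≐t = representative (_ , t∈) in
    m , m∈ , ψ , v' , t , w≐v' , m≐t , v'∈ , t∈

  Case₁-unique : ∀ {w u u'} → Case₁ (lab w) u → Case₁ (lab w) u' → u ≡ u'
  Case₁-unique (u∈ , _ , v , t , w≐v , u≐t , v∈ , t∈)
               (u'∈ , _ , v' , t' , w≐v' , u'≐t' , v'∈ , t'∈) =
    let t≐t' = EqRule⇒∈ (r≡¬ v∈ v'∈ (≐-trans (≐-sym w≐v) w≐v') t∈ t'∈) in
    ML-unique u∈ u'∈ (≐-trans u≐t (≐-trans t≐t' (≐-sym u'≐t')))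

  Case₁⇒opposite-polarity : ∀ {w u} → Case₁ (lab w) u → positive u ≢ positive w
  Case₁⇒opposite-polarity (_ , _ , v' , t , w≐v' , u≐t , v'∈ , t∈) u≡w =
    let x , x≢t , x∈ = negation-decomposed (branch-NegationsDecomposed branch) t∈
        x≐w = ≐-trans (EqRule⇒∈ (rF x∈ v'∈)) (≐-sym w≐v')
    in x≢t (trans (≐⇒same-polarity x≐w) (trans (sym u≡w) (≐⇒same-polarity u≐t)))

  MLp-opposite : ∀ {u w} → InML (lab u) → InML (lab w) →
    positive u ≢ positive w → MLp u ⇔ (¬ MLp w)
  MLp-opposite {u} {w} u∈ w∈ u≢w = mk⇔ exclusive (exhaustive u∈ w∈)
    where
    exclusive : MLp u → ¬ MLp w
    exclusive u∈p w∈p = u≢w (trans (MLp⇒positive u∈p) (sym (MLp⇒positive w∈p)))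
    exhaustive : InML (lab u) → InML (lab w) → ¬ MLp w → MLp u
    exhaustive (inj₁ u∈p) _ _ = u∈p
    exhaustive (inj₂ _) (inj₁ w∈p) w∉p = contradiction w∈p w∉p
    exhaustive (inj₂ u∈n) (inj₂ w∈n) _ =
      contradiction (trans (MLn⇒negative u∈n) (sym (MLn⇒negative w∈n))) u≢w

  w⁻∈U : InU (lab (neg n))
  w⁻∈U = inj₂ (proj₂ (proj₂ isMLn))

  NegRel-functional : ∀ {e u u'} → InU e → NegRel e u → NegRel e u' → u' ≡ u
  NegRel-functional {wplus} _ (case₁ c) _ = contradiction c ¬Case₁-w⁺
  NegRel-functional {wplus} _ _ (case₁ c) = contradiction c ¬Case₁-w⁺
  NegRel-functional {lab _} _ (case₁ c) (case₁ c') = cong lab (Case₁-unique c' c)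
  NegRel-functional {lab _} e∈ (case₁ c) (case₂ ¬closed _) =
    contradiction (Case₁⇒NegClosed e∈ c) ¬closed
  NegRel-functional {lab _} e∈ (case₂ ¬closed _) (case₁ c) =
    contradiction (Case₁⇒NegClosed e∈ c) ¬closed
  NegRel-functional {lab _} _ (case₁ c) (case₃ ¬c _) = contradiction c (¬c _)
  NegRel-functional {lab _} _ (case₃ ¬c _) (case₁ c) = contradiction c (¬c _)
  NegRel-functional _ (case₂ _ _) (case₂ _ _) = refl
  NegRel-functional _ (case₂ ¬closed ∉D) (case₃ _ ¬case₂) =
    contradiction (¬closed , ∉D) ¬case₂
  NegRel-functional _ (case₃ _ ¬case₂) (case₂ ¬closed ∉D) =
    contradiction (¬closed , ∉D) ¬case₂
  NegRel-functional _ (case₃ _ _) (case₃ _ _) = refl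

  NegRel-total : ∀ e → InU e → ∃[ u ] InU u × NegRel e u
  NegRel-total wplus _ =
    lab (neg n) , w⁻∈U , case₃ (λ _ → ¬Case₁-w⁺) (λ ¬case₂ → proj₂ ¬case₂ tt)
  NegRel-total (lab w) e∈ with negatedClass? w
  ... | yes negated =
    let u , c = NegatedClass⇒Case₁ negated in lab u , proj₁ c , case₁ c
  NegRel-total (lab w) (inj₁ w∈p) | no ¬negated =
    lab (neg n) , w⁻∈U ,
    case₃ (¬NegatedClass⇒¬Case₁ ¬negated) (λ ¬case₂ → proj₂ ¬case₂ w∈p)
  NegRel-total (lab w) (inj₂ w∈n) | no ¬negated =
    wplus , inj₁ tt ,
    case₂ (¬Case₁⇒¬NegClosed (¬NegatedClass⇒¬Case₁ ¬negated)) (MLn⇒¬MLp w∈n)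

  NegRel-swaps-D : ∀ {e u} → InU e → NegRel e u → InD u ⇔ (¬ InD e)
  NegRel-swaps-D {wplus} _ (case₁ c) = contradiction c ¬Case₁-w⁺
  NegRel-swaps-D {lab _} e∈ (case₁ c) =
    MLp-opposite (proj₁ c) e∈ (Case₁⇒opposite-polarity c)
  NegRel-swaps-D _ (case₂ _ ∉D) = mk⇔ (λ _ → ∉D) (λ _ → tt)
  NegRel-swaps-D _ (case₃ ¬c ¬case₂) =
    mk⇔ (λ w⁻∈p → contradiction w⁻∈p (MLn⇒¬MLp (proj₂ (proj₂ isMLn))))
        (λ ∉D → contradiction (¬Case₁⇒¬NegClosed ¬c , ∉D) ¬case₂)

proposition7 : (φ : Fm) (n : ℕ) (S : State) →
    IsBranch n φ S → Open S → FullyExpanded S →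
    (MLp MLn : Label → Set) →
    IsMLpos (items S) MLp → IsMLneg (items S) n MLn →
    ((e : Elem) → Structure.InU (items S) MLp MLn n e →
       Σ[ u ∈ Elem ] Structure.InU (items S) MLp MLn n u ×
         Structure.NegRel (items S) MLp MLn n e u ×
         ((u' : Elem) → Structure.NegRel (items S) MLp MLn n e u' → u' ≡ u)) ×
    ((e u : Elem) → Structure.InU (items S) MLp MLn n e →
       Structure.NegRel (items S) MLp MLn n e u →
       (Structure.InD (items S) MLp MLn n u ⇔ (¬ Structure.InD (items S) MLp MLn n e)))
proposition7 φ n S branch S-open S-expanded MLp MLn isMLp isMLn =
  (λ e e∈ → let u , u∈ , e↦u = NegRel-total e e∈ in
            u , u∈ , e↦u , λ _ e↦u' → NegRel-functional e∈ e↦u e↦u') ,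
  (λ _ _ e∈ e↦u → NegRel-swaps-D e∈ e↦u)
  where open Negation branch S-open S-expanded MLp MLn isMLp isMLn
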